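{- Every integer $n\ge 2$ is a cutoff.
   Context: For a real number $\alpha\ge 1$, define the integer sequence $(P^\alpha_i)_{i\ge 0}$ by $P^\alpha_0=0$, $P^\alpha_1=1$, and for $k\ge 1$, $P^\alpha_{k+1}=P^\alpha_k+P^\alpha_j$, where $j$ is the unique index with $\alpha P^\alpha_{j-1}<P^\alpha_k\le \alpha P^\alpha_j$. A cutoff is a real number $\alpha\ge 1$ such that for every real $\beta$ with $1\le\beta<\alpha$, the sequences $(P^\alpha_i)$ and $(P^\beta_i)$ are not identical. -}

module Defs where

open import Data.Nat as ℕ using (ℕ; zero; suc)
open import Data.Integer as ℤ using (+_)
open import Data.Rational as ℚ using (ℚ; _/_; 0ℚ; 1ℚ)
open import Data.Rational.Properties as ℚP
open import Data.Product using (Σ; ∃; ∃-syntax; _×_; _,_)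
open import Relation.Nullary using (¬_)
open import Relation.Binary.PropositionalEquality using (_≡_; refl; subst)

ℕ→ℚ : ℕ → ℚ
ℕ→ℚ n = + n / 1

-- A real number β is represented by its (open) upper Dedekind cut
-- U = { q ∈ ℚ | β < q }.  Classically, these records correspond
-- exactly to the real numbers (β = inf U).
record ℝ : Set₁ where
  field
    U            : ℚ → Set
    upward       : ∀ {p q} → p ℚ.≤ q → U p → U q
    rounded      : ∀ {q} → U q → ∃[ r ] (r ℚ.< q × U r)
    inhabited    : ∃[ q ] U q
    boundedBelow : ∃[ q ] ¬ U q
open ℝ public

ofℕ : ℕ → ℝ
ofℕ n = record
  { U            = λ q → ℕ→ℚ n ℚ.< q
  ; upward       = λ p≤q np → ℚP.<-≤-trans np p≤q
  ; rounded      = λ {q} nq → let (m , n<m , m<q) = ℚP.<-dense nq in m , m<q , n<m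
  ; inhabited    = ℕ→ℚ n ℚ.+ 1ℚ
                 , subst (ℚ._< ℕ→ℚ n ℚ.+ 1ℚ) (ℚP.+-identityʳ (ℕ→ℚ n))
                     (ℚP.+-monoʳ-< (ℕ→ℚ n) 0<1)
  ; boundedBelow = ℕ→ℚ n , ℚP.<-irrefl refl
  }
  where
  0<1 : 0ℚ ℚ.< 1ℚ
  0<1 = ℚ.*<* (ℤ.+<+ (ℕ.s≤s ℕ.z≤n))

-- Order relations between reals.
-- β < α  iff  there is a rational q with β < q ≤ α.
_<ℝ_ : ℝ → ℝ → Set
β <ℝ α = ∃[ q ] (U β q × ¬ U α q)

1≤ℝ_ : ℝ → Set
1≤ℝ α = ¬ U α 1ℚ

-- α · a < b  (a, b ∈ ℕ)  iff  some rational q > α has q · a < b.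
MulLt : ℝ → ℕ → ℕ → Set
MulLt α a b = ∃[ q ] (U α q × q ℚ.* ℕ→ℚ a ℚ.< ℕ→ℚ b)

MulGe : ℝ → ℕ → ℕ → Set
MulGe α a b = ¬ MulLt α a b

-- s is the sequence (P^α_i): P_0 = 0, P_1 = 1, and for k ≥ 1,
-- P_{k+1} = P_k + P_j where j ≥ 1 is the unique index with
-- α P_{j-1} < P_k ≤ α P_j.  (We write j = suc i.)
IndexCond : ℝ → (ℕ → ℕ) → ℕ → ℕ → Set
IndexCond α s k i = MulLt α (s i) (s k) × MulGe α (s (suc i)) (s k)

IsPSeq : ℝ → (ℕ → ℕ) → Set
IsPSeq α s =
  (s 0 ≡ 0) × (s 1 ≡ 1) ×
  (∀ k → 1 ℕ.≤ k →
     ∃[ i ] ( IndexCond α s k i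
            × (∀ i′ → IndexCond α s k i′ → i′ ≡ i)
            × s (suc k) ≡ s k ℕ.+ s (suc i)))


IsCutoff : ℝ → Set₁
IsCutoff α =
  1≤ℝ α ×
  (∀ (β : ℝ) → 1≤ℝ β → β <ℝ α →
     ∀ (s t : ℕ → ℕ) → IsPSeq α s → IsPSeq β t → ¬ (∀ i → s i ≡ t i))

module Submission where

-- Let 1 ≤ β < n and write s = P^n, t = P^β.  While P^n_k ≤ n the index
-- j = 1 is admissible (n·P_0 = 0 < P_k ≤ n = n·P_1), so by uniqueness
-- P^n_{k+1} = P^n_k + 1; hence P^n_k = k for all k ≤ n + 1.  If the two
-- sequences agreed, then t_n = n, and since β·P_1 = β < n the index j = 1
-- is NOT admissible at step n for β; the chosen index j is thus ≥ 2, and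
-- as every P-sequence satisfies P_j ≥ j we get t_{n+1} = n + t_j ≥ n + 2,
-- contradicting t_{n+1} = s_{n+1} = n + 1.

open import Defs
open import Data.Nat as ℕ using (ℕ; zero; suc; _+_; _≤_; z≤n; s≤s)
import Data.Nat.Properties as ℕP
open import Data.Integer as ℤ using (+_)
import Data.Integer.Properties as ℤP
open import Data.Rational as ℚ using (ℚ; mkℚ)
import Data.Rational.Properties as ℚP
import Data.Nat.Coprimality as Coprime
open import Data.Product using (∃-syntax; _×_; _,_)
open import Data.Empty using (⊥-elim)
open import Function using (_∘_)
open import Relation.Nullary using (¬_)
open import Relation.Binary.PropositionalEquality

-- ℕ→ℚ n is the normalised fraction n/1, so comparisons of embedded
-- naturals reduce to comparisons of their numerators.
ℕ→ℚ-normal : ∀ n → ℕ→ℚ n ≡ mkℚ (+ n) 0 (Coprime.sym (Coprime.1-coprimeTo n))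
ℕ→ℚ-normal n = ℚP.normalize-coprime (Coprime.sym (Coprime.1-coprimeTo n))

ℕ→ℚ-mono-≤ : ∀ {m n} → m ≤ n → ℕ→ℚ m ℚ.≤ ℕ→ℚ n
ℕ→ℚ-mono-≤ {m} {n} m≤n rewrite ℕ→ℚ-normal m | ℕ→ℚ-normal n =
  ℚ.*≤* (subst₂ ℤ._≤_ (sym (ℤP.*-identityʳ (+ m))) (sym (ℤP.*-identityʳ (+ n)))
                      (ℤ.+≤+ m≤n))

ℕ→ℚ-mono-< : ∀ {m n} → m ℕ.< n → ℕ→ℚ m ℚ.< ℕ→ℚ n
ℕ→ℚ-mono-< {m} {n} m<n rewrite ℕ→ℚ-normal m | ℕ→ℚ-normal n =
  ℚ.*<* (subst₂ ℤ._<_ (sym (ℤP.*-identityʳ (+ m))) (sym (ℤP.*-identityʳ (+ n)))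
                      (ℤ.+<+ m<n))

ofℕ-notAbove : ∀ {m n} → m ≤ n → ¬ U (ofℕ n) (ℕ→ℚ m)
ofℕ-notAbove m≤n n<m = ℚP.<-irrefl refl (ℚP.<-≤-trans n<m (ℕ→ℚ-mono-≤ m≤n))

mulLt-zero : ∀ (α : ℝ) {b} → 1 ≤ b → MulLt α 0 b
mulLt-zero α 1≤b with inhabited α
... | q , αq = q , αq , subst (ℚ._< _) (sym (ℚP.*-zeroʳ q)) (ℕ→ℚ-mono-< 1≤b)

mulGe-one : ∀ (α : ℝ) {b} → ¬ U α (ℕ→ℚ b) → MulGe α 1 b
mulGe-one α b≤α (q , αq , q·1<b) =
  b≤α (upward α (ℚP.<⇒≤ (subst (ℚ._< _) (ℚP.*-identityʳ q) q·1<b)) αq)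

-- If β < q ≤ b then β · 1 < b; roundedness supplies the strict margin.
mulLt-one : ∀ (β : ℝ) {q b} → U β q → q ℚ.≤ ℕ→ℚ b → MulLt β 1 b
mulLt-one β βq q≤b with rounded β βq
... | r , r<q , βr =
  r , βr , subst (ℚ._< _) (sym (ℚP.*-identityʳ r)) (ℚP.<-≤-trans r<q q≤b)

-- Growth of an arbitrary P-sequence: every later term adds a positive
-- term, so P_k ≥ k.
module PSequence (α : ℝ) (s : ℕ → ℕ) (P : IsPSeq α s) where

  s₁≡1 : s 1 ≡ 1
  s₁≡1 = let (_ , s1 , _) = P in s1

  recursion : ∀ k → ∃[ i ] ( IndexCond α s (suc k) i
                           × (∀ i′ → IndexCond α s (suc k) i′ → i′ ≡ i)
                           × s (suc (suc k)) ≡ s (suc k) + s (suc i))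
  recursion k = let (_ , _ , step) = P in step (suc k) (s≤s z≤n)

  positive : ∀ k → 1 ≤ s (suc k)
  positive zero = ℕP.≤-reflexive (sym s₁≡1)
  positive (suc k) with recursion k
  ... | i , _ , _ , eq =
    ℕP.≤-trans (positive k) (subst (s (suc k) ≤_) (sym eq) (ℕP.m≤m+n _ _))

  lowerBound : ∀ k → k ≤ s k
  lowerBound zero = z≤n
  lowerBound (suc zero) = ℕP.≤-reflexive (sym s₁≡1)
  lowerBound (suc (suc k)) =
    let (i , _ , _ , eq) = recursion k
    in subst (suc (suc k) ≤_) (sym eq)
         (subst (_≤ s (suc k) + s (suc i)) (ℕP.+-comm (suc k) 1)
           (ℕP.+-mono-≤ (lowerBound (suc k)) (positive i)))

-- For α = n and 1 ≤ P_k ≤ n the index j = 1 is admissible at step k: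
-- n · P_0 = 0 < P_k ≤ n = n · P_1.
ofℕ-unitIndex : ∀ n s → IsPSeq (ofℕ n) s → ∀ {k} → 1 ≤ s k → s k ≤ n →
                IndexCond (ofℕ n) s k 0
ofℕ-unitIndex n s (s₀≡0 , s₁≡1 , _) {k} 1≤sₖ sₖ≤n =
    subst (λ z → MulLt (ofℕ n) z (s k)) (sym s₀≡0) (mulLt-zero (ofℕ n) 1≤sₖ)
  , subst (λ z → MulGe (ofℕ n) z (s k)) (sym s₁≡1) (mulGe-one (ofℕ n) {s k} (ofℕ-notAbove sₖ≤n))

-- Hence, by uniqueness of the index, P^n starts 0, 1, 2, …, n + 1.
ofℕ-initial : ∀ n s → IsPSeq (ofℕ n) s → ∀ k → k ≤ n → s (suc k) ≡ suc k
ofℕ-initial n s P zero _ = PSequence.s₁≡1 (ofℕ n) s P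
ofℕ-initial n s P (suc k) k<n with PSequence.recursion (ofℕ n) s P k
... | i , _ , unique , eq = begin
  s (suc (suc k))        ≡⟨ eq ⟩
  s (suc k) + s (suc i)  ≡⟨ cong₂ _+_ sₖ≡k (trans (cong (s ∘ suc) i≡0) s₁≡1) ⟩
  suc k + 1              ≡⟨ ℕP.+-comm (suc k) 1 ⟩
  suc (suc k)            ∎
  where
  open ≡-Reasoning
  open PSequence (ofℕ n) s P using (s₁≡1; positive)
  sₖ≡k : s (suc k) ≡ suc k
  sₖ≡k = ofℕ-initial n s P k (ℕP.<⇒≤ k<n)
  i≡0 : i ≡ 0
  i≡0 = sym (unique 0 (ofℕ-unitIndex n s P (positive k) (subst (_≤ n) (sym sₖ≡k) k<n)))

-- If β · 1 < n and P^β_n = n, then j = 1 is not admissible at step n,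
-- so the chosen index j is at least 2 and P^β_{n+1} ≥ n + 2.
below-jump : ∀ (β : ℝ) n t → IsPSeq β t → 1 ≤ n → MulLt β 1 n → t n ≡ n →
             suc (suc n) ≤ t (suc n)
below-jump β n t P@(_ , t₁≡1 , step) 1≤n β<n tₙ≡n with step n 1≤n
... | zero , (_ , n≤β) , _ , _ =
  ⊥-elim (n≤β (subst₂ (MulLt β) (sym t₁≡1) (sym tₙ≡n) β<n))
... | suc i , _ , _ , eq = subst (suc (suc n) ≤_) (sym eq)
  (subst (_≤ t n + t (suc (suc i))) (ℕP.+-comm n 2)
    (ℕP.+-mono-≤ (ℕP.≤-reflexive (sym tₙ≡n))
                 (ℕP.≤-trans (s≤s (s≤s z≤n)) (PSequence.lowerBound β t P (suc (suc i))))))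

-- The hypothesis 2 ≤ n only serves to exclude n = 0; the argument needs n ≥ 1.
theorem6p9 : ∀ (n : ℕ) → 2 ≤ n → IsCutoff (ofℕ n)
theorem6p9 n@(suc m) _ = ofℕ-notAbove 1≤n , sequencesDiffer
  where
  1≤n : 1 ≤ n
  1≤n = s≤s z≤n
  sequencesDiffer : ∀ (β : ℝ) → 1≤ℝ β → β <ℝ ofℕ n →
    ∀ (s t : ℕ → ℕ) → IsPSeq (ofℕ n) s → IsPSeq β t → ¬ (∀ i → s i ≡ t i)
  sequencesDiffer β _ (q , βq , q≤n) s t Pₙ Pᵦ s≡t =
    ℕP.<-irrefl refl (subst (suc (suc n) ≤_) tₙ₊₁≡n+1 jump)
    where
    sₙ≡n : s n ≡ n
    sₙ≡n = ofℕ-initial n s Pₙ m (ℕP.n≤1+n m)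
    tₙ₊₁≡n+1 : t (suc n) ≡ suc n
    tₙ₊₁≡n+1 = trans (sym (s≡t (suc n))) (ofℕ-initial n s Pₙ n ℕP.≤-refl)
    jump : suc (suc n) ≤ t (suc n)
    jump = below-jump β n t Pᵦ 1≤n (mulLt-one β {b = n} βq (ℚP.≮⇒≥ q≤n))
                      (trans (sym (s≡t n)) sₙ≡n)
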